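{- Let $G$ and $H$ be connected regular graphs. If $G$ is a nontrivial class 1 graph, then $\check s(G\,\Box\, H)=1$.
   Context: All graphs are finite and simple; nontrivial means having at least two vertices. A proper edge-coloring assigns colors to edges so that incident edges receive different colors. For a proper edge-coloring $f$ of $G$, the palette of a vertex $v$ is $P_f(v)=\{f(e): e \text{ incident to } v\}$. The palette index $\check s(G)$ is the minimum, over all proper edge-colorings $f$, of the number of distinct palettes among the vertices. A graph is class 1 if its chromatic index equals its maximum degree. The Cartesian product $G\,\Box\, H$ has vertex set $V(G)\times V(H)$, with $(x_1,x_2)(y_1,y_2)$ an edge iff either $x_1y_1\in E(G)$ and $x_2=y_2$, or $x_2y_2\in E(H)$ and $x_1=y_1$. -}

module Defs where

open import Data.Nat using (ℕ; zero; suc; _*_; _<_; _≤_; _⊔_)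
open import Data.Fin using (Fin; remQuot; _≟_)
open import Data.Fin.Subset using (∣_∣)
open import Data.Vec using (tabulate)
open import Data.List using (foldr; map; allFin)
open import Data.Bool using (Bool; true; false; _∧_; _∨_)
open import Data.Product using (Σ; ∃; _×_; _,_; proj₁; proj₂)
open import Function.Bundles using (_⇔_)
open import Relation.Nullary using (¬_)
open import Relation.Nullary.Decidable using (⌊_⌋)
open import Relation.Binary.PropositionalEquality using (_≡_; _≢_)

record Graph (n : ℕ) : Set where
  field
    adj : Fin n → Fin n → Bool
open Graph public

IsSimple : ∀ {n} → Graph n → Set
IsSimple {n} G = (∀ (u v : Fin n) → adj G u v ≡ adj G v u) × (∀ (u : Fin n) → adj G u u ≡ false)

Nontrivial : ∀ {n} → Graph n → Set
Nontrivial {n} G = 2 ≤ n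

deg : ∀ {n} → Graph n → Fin n → ℕ
deg G v = ∣ tabulate (adj G v) ∣

maxDeg : ∀ {n} → Graph n → ℕ
maxDeg {n} G = foldr _⊔_ 0 (map (deg G) (allFin n))

Regular : ∀ {n} → Graph n → Set
Regular {n} G = ∃ λ d → ∀ (v : Fin n) → deg G v ≡ d

data Walk {n : ℕ} (G : Graph n) : Fin n → Fin n → Set where
  here : ∀ {u} → Walk G u u
  step : ∀ {u w v} → adj G u w ≡ true → Walk G w v → Walk G u v

Connected : ∀ {n} → Graph n → Set
Connected {n} G = (0 < n) × (∀ (u v : Fin n) → Walk G u v)

-- An edge-colouring: assigns a colour (a natural number) to every ordered
-- pair; only values on edges matter. It must be symmetric on edges.
EdgeColouring : ℕ → Set
EdgeColouring n = Fin n → Fin n → ℕ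

IsProper : ∀ {n} → Graph n → EdgeColouring n → Set
IsProper {n} G f =
  (∀ (u v : Fin n) → adj G u v ≡ true → f u v ≡ f v u) ×
  (∀ (u v w : Fin n) → adj G u v ≡ true → adj G u w ≡ true → v ≢ w → f u v ≢ f u w)

UsesColours : ∀ {n} → Graph n → EdgeColouring n → ℕ → Set
UsesColours {n} G f k = ∀ (u v : Fin n) → adj G u v ≡ true → f u v < k

ChromaticIndex : ∀ {n} → Graph n → ℕ → Set
ChromaticIndex G k =
  (Σ (EdgeColouring _) λ f → IsProper G f × UsesColours G f k) ×
  (∀ m → (Σ (EdgeColouring _) λ f → IsProper G f × UsesColours G f m) → k ≤ m)

Class1 : ∀ {n} → Graph n → Set
Class1 G = ChromaticIndex G (maxDeg G)

InPalette : ∀ {n} → Graph n → EdgeColouring n → Fin n → ℕ → Set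
InPalette G f v c = ∃ λ w → adj G v w ≡ true × f v w ≡ c

SamePalette : ∀ {n} → Graph n → EdgeColouring n → Fin n → Fin n → Set
SamePalette G f u v = ∀ c → InPalette G f u c ⇔ InPalette G f v c

-- f has exactly k distinct palettes: a surjective labelling of vertices by
-- Fin k whose fibres are exactly the classes of "same palette".
NumPalettes : ∀ {n} → Graph n → EdgeColouring n → ℕ → Set
NumPalettes {n} G f k = Σ (Fin n → Fin k) λ cl →
  (∀ (i : Fin k) → ∃ λ v → cl v ≡ i) ×
  (∀ (u v : Fin n) → (cl u ≡ cl v) ⇔ SamePalette G f u v)

PaletteIndex : ∀ {n} → Graph n → ℕ → Set
PaletteIndex G k =
  (Σ (EdgeColouring _) λ f → IsProper G f × NumPalettes G f k) ×
  (∀ f m → IsProper G f → NumPalettes G f m → k ≤ m)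

_□_ : ∀ {n m} → Graph n → Graph m → Graph (n * m)
_□_ {n} {m} G H = record { adj = λ i j → prodAdj (remQuot {n} m i) (remQuot {n} m j) }
  where
  prodAdj : Fin n × Fin m → Fin n × Fin m → Bool
  prodAdj (x₁ , x₂) (y₁ , y₂) =
    (adj G x₁ y₁ ∧ ⌊ x₂ ≟ y₂ ⌋) ∨ (adj H x₂ y₂ ∧ ⌊ x₁ ≟ y₁ ⌋)

-- By Vizing's theorem the r-regular graph H has a proper colouring with the colours 0, …, r, and then
-- every vertex y of H misses exactly one of them, say μ(y). The class 1 graph G is d-regular, so a proper
-- colouring with the colours 0, …, d − 1 shows all of them at every vertex; d ≥ 1 because G is connected
-- and nontrivial. In G □ H keep the colours of the copies of H, and give a G-edge of colour t in the layer
-- over y the colour μ(y) if t = 0 and r + t otherwise. This colouring is proper and every vertex sees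
-- exactly the colours 0, …, r + d − 1, so there is a single palette.
--
-- Vizing's theorem is proved by colouring the edges one at a time: a new edge uv is coloured by growing a
-- fan at u starting from v and rotating it once its last colour is free at u, after an α/β Kempe change if
-- the fan closes up on itself first.

module Submission where

open import Defs
open import Data.Nat using (ℕ; zero; suc; _+_; _∸_; _*_; _≤_; _<_; z≤n; s≤s; s≤s⁻¹; _<?_; pred; _⊔_)
open import Data.Nat.Properties
  using (≤-antisym; +-comm; suc-injective; +-suc; +-identityʳ; <⇒≢; +-cancelˡ-≡; anyUpTo?; ≤-refl; ≤-trans; <-cmp;
         m≤n⇒m<n∨m≡n; n<1+n; ≰⇒>; <⇒≤; <-trans; <-≤-trans; n≮0; m≤m+n; +-monoʳ-<; +-cancelˡ-<;
         m+[n∸m]≡n; ≮⇒≥; ⊔-lub; ≤-reflexive)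
import Data.Nat.Properties as ℕ
open import Data.Fin using (Fin; zero; suc; toℕ; fromℕ<; remQuot; combine; _≟_)
import Data.Fin as Fin
import Data.Fin.Properties as Finₚ
open import Data.Fin.Properties
  using (any?; toℕ-fromℕ<; toℕ-injective; toℕ<n; pigeonhole; combine-injectiveˡ; combine-injectiveʳ;
         remQuot-combine; combine-remQuot)
open import Data.Fin.Subset using (∣_∣)
open import Data.Fin.Subset.Properties using (∣p∣≤n)
open import Data.Vec using (tabulate)
open import Data.Vec.Properties using (tabulate-cong)
open import Data.List using (List; []; _∷_; foldr; map; allFin)
open import Data.Bool using (Bool; true; false; not; _∧_; _∨_; if_then_else_)
open import Data.Bool.Properties using (∧-identityʳ; ∧-zeroʳ; ∨-comm; ∨-zeroʳ; not-injective; ¬-not)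
import Data.Bool.Properties as Bool
open import Data.Maybe using (Maybe; just; nothing; _>>=_)
import Data.Maybe as Maybe
open import Data.Maybe.Properties using (just-injective)
open import Data.Product using (∃; ∃₂; _×_; _,_; proj₁; proj₂)
open import Data.Sum using (_⊎_; inj₁; inj₂)
import Data.Sum as Sum
open import Function using (_∘_)
open import Function.Bundles using (_⇔_; mk⇔)
import Function.Properties.Equivalence as ⇔
open import Relation.Nullary using (¬_; Dec; yes; no; does; _×-dec_; _⊎-dec_; contradiction)
open import Relation.Nullary.Decidable using (⌊_⌋; dec-true; dec-false; does-⇔; isYes≗does)
import Relation.Nullary.Decidable as Dec
open import Relation.Binary.Definitions using (tri<; tri≈; tri>)
open import Relation.Binary.PropositionalEquality using (_≡_; _≢_; refl; sym; trans; cong; subst; subst₂)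

-- Counting
count : ∀ {n} → (Fin n → Bool) → ℕ
count p = ∣ tabulate p ∣

_─_ : ∀ {n} → (Fin n → Bool) → Fin n → Fin n → Bool
(p ─ a) i = p i ∧ not (does (i ≟ a))

count-cong : ∀ {n} {p q : Fin n → Bool} → (∀ i → p i ≡ q i) → count p ≡ count q
count-cong p≗q = cong ∣_∣ (tabulate-cong p≗q)

count-─ : ∀ {n} (p : Fin n → Bool) a → p a ≡ true → count p ≡ suc (count (p ─ a))
count-─ p zero pa rewrite pa = cong suc (count-cong (λ i → sym (∧-identityʳ (p (suc i)))))
count-─ p (suc a) pa with p zero
... | true = cong suc (count-─ (p ∘ suc) a pa)
... | false = count-─ (p ∘ suc) a pa

count-≤-injection : ∀ {n n′} (p : Fin n → Bool) (q : Fin n′ → Bool) (f : ∀ i → p i ≡ true → Fin n′) →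
  (∀ i pi → q (f i pi) ≡ true) → (∀ i j pi pj → f i pi ≡ f j pj → i ≡ j) → count p ≤ count q
count-≤-injection {zero} p q f f∈q f-inj = z≤n
count-≤-injection {suc n} p q f f∈q f-inj with p zero in p₀
... | false = count-≤-injection (p ∘ suc) q (f ∘ suc) (f∈q ∘ suc)
                (λ i j pi pj → Finₚ.suc-injective ∘ f-inj (suc i) (suc j) pi pj)
... | true = subst (suc (count (p ∘ suc)) ≤_) (sym (count-─ q (f zero p₀) (f∈q zero p₀)))
               (s≤s (count-≤-injection (p ∘ suc) (q ─ f zero p₀) (f ∘ suc) f∈q′
                 (λ i j pi pj → Finₚ.suc-injective ∘ f-inj (suc i) (suc j) pi pj)))
  where
  f∈q′ : ∀ i pi → (q ─ f zero p₀) (f (suc i) pi) ≡ true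
  f∈q′ i pi rewrite f∈q (suc i) pi
    | dec-false (f (suc i) pi ≟ f zero p₀) (λ eq → contradiction (f-inj (suc i) zero pi p₀ eq) λ ()) = refl

count-mono : ∀ {n} {p q : Fin n → Bool} → (∀ i → p i ≡ true → q i ≡ true) → count p ≤ count q
count-mono {p = p} {q} p⊆q = count-≤-injection p q (λ i _ → i) p⊆q (λ _ _ _ _ eq → eq)

count-mono-< : ∀ {n} {p q : Fin n → Bool} → (∀ i → p i ≡ true → q i ≡ true) →
  ∀ a → p a ≡ false → q a ≡ true → count p < count q
count-mono-< {p = p} {q} p⊆q a pa qa = subst (count p <_) (sym (count-─ q a qa)) (s≤s (count-mono p⊆q─a))
  where
  p⊆q─a : ∀ i → p i ≡ true → (q ─ a) i ≡ true
  p⊆q─a i pi rewrite p⊆q i pi | dec-false (i ≟ a) (λ { refl → contradiction (trans (sym pi) pa) λ () }) = refl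

count-positive : ∀ {n} {p : Fin n → Bool} a → p a ≡ true → 0 < count p
count-positive {p = p} a pa rewrite count-─ p a pa = s≤s z≤n

count-witness : ∀ {n} (p : Fin n → Bool) → 0 < count p → ∃ λ i → p i ≡ true
count-witness {suc n} p pos with p zero in p₀
... | true = zero , p₀
... | false with count-witness (p ∘ suc) pos
... | i , pi = suc i , pi

count≡0⇒false : ∀ {n} (p : Fin n → Bool) → count p ≡ 0 → ∀ i → p i ≡ false
count≡0⇒false p c≡0 i with p i in pi
... | false = refl
... | true = contradiction (subst (0 <_) c≡0 (count-positive i pi)) λ ()

count-complement : ∀ {n} (p : Fin n → Bool) → count p + count (not ∘ p) ≡ n
count-complement {zero} p = refl
count-complement {suc n} p with p zero
... | true = cong suc (count-complement (p ∘ suc))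
... | false = trans (+-suc _ _) (cong suc (count-complement (p ∘ suc)))

-- Palettes of proper colourings
record IsColouring {n} (k : ℕ) (G : Graph n) (c : EdgeColouring n) : Set where
  field
    colour-sym : ∀ x y → adj G x y ≡ true → c x y ≡ c y x
    colour-proper : ∀ x y z → adj G x y ≡ true → adj G x z ≡ true → y ≢ z → c x y ≢ c x z
    colour-< : ∀ x y → adj G x y ≡ true → c x y < k
open IsColouring public

dec-true⁻¹ : ∀ {P : Set} (P? : Dec P) → does P? ≡ true → P
dec-true⁻¹ (yes p) _ = p

module _ {n} (G : Graph n) (c : EdgeColouring n) where

  inPalette? : ∀ x γ → Dec (InPalette G c x γ)
  inPalette? x γ = any? (λ y → (adj G x y Bool.≟ true) ×-dec (c x y ℕ.≟ γ))

  missingᵇ : Fin n → ∀ {k} → Fin k → Bool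
  missingᵇ x i = not (does (inPalette? x (toℕ i)))

  missingᵇ-true : ∀ x {k} (i : Fin k) → missingᵇ x i ≡ true → ¬ InPalette G c x (toℕ i)
  missingᵇ-true x i _ with inPalette? x (toℕ i)
  ... | no ∉ = ∉

  missingᵇ-false : ∀ x {k} (i : Fin k) → missingᵇ x i ≡ false → InPalette G c x (toℕ i)
  missingᵇ-false x i _ with inPalette? x (toℕ i)
  ... | yes ∈ = ∈


module _ {n k} {G : Graph n} {c : EdgeColouring n} (col : IsColouring k G c) where

  colour-injective : ∀ x y z → adj G x y ≡ true → adj G x z ≡ true → c x y ≡ c x z → y ≡ z
  colour-injective x y z xy xz eq with y ≟ z
  ... | yes y≡z = y≡z
  ... | no y≢z = contradiction eq (colour-proper col x y z xy xz y≢z)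

  -- The colouring is a bijection from the neighbours of x onto the colours present at x.
  deg+missing≡k : ∀ x → deg G x + count (missingᵇ G c x {k}) ≡ k
  deg+missing≡k x = subst (λ d → d + count (not ∘ present) ≡ k) (≤-antisym present≤deg deg≤present)
                      (count-complement present)
    where
    present : Fin k → Bool
    present i = does (inPalette? G c x (toℕ i))
    deg≤present : deg G x ≤ count present
    deg≤present = count-≤-injection (adj G x) present (λ y xy → fromℕ< (colour-< col x y xy))
      (λ y xy → dec-true (inPalette? G c x _) (y , xy , sym (toℕ-fromℕ< _)))
      (λ y z xy xz eq → colour-injective x y z xy xz
         (trans (sym (toℕ-fromℕ< _)) (trans (cong toℕ eq) (toℕ-fromℕ< _))))
    present≤deg : count present ≤ deg G x
    present≤deg = count-≤-injection present (adj G x) (λ i pi → proj₁ (dec-true⁻¹ (inPalette? G c x (toℕ i)) pi))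
      (λ i pi → proj₁ (proj₂ (dec-true⁻¹ (inPalette? G c x (toℕ i)) pi)))
      (λ i j pi pj eq → toℕ-injective (trans (sym (proj₂ (proj₂ (dec-true⁻¹ (inPalette? G c x (toℕ i)) pi))))
         (trans (cong (c x) eq) (proj₂ (proj₂ (dec-true⁻¹ (inPalette? G c x (toℕ j)) pj))))))

  missing-colour : ∀ x → deg G x < k → ∃ λ γ → γ < k × ¬ InPalette G c x γ
  missing-colour x deg<k with count-witness (missingᵇ G c x) missing>0
    where
    missing>0 : 0 < count (missingᵇ G c x {k})
    missing>0 with count (missingᵇ G c x {k}) | deg+missing≡k x
    ... | zero | deg+0≡k = contradiction (trans (sym (+-identityʳ _)) deg+0≡k) (<⇒≢ deg<k)
    ... | suc _ | _ = s≤s z≤n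
  ... | i , mi = toℕ i , toℕ<n i , missingᵇ-true G c x i mi

  palette-complete : ∀ x → deg G x ≡ k → ∀ γ → γ < k → InPalette G c x γ
  palette-complete x deg≡k γ γ<k = subst (InPalette G c x) (toℕ-fromℕ< γ<k)
    (missingᵇ-false G c x (fromℕ< γ<k) (count≡0⇒false (missingᵇ G c x) no-missing (fromℕ< γ<k)))
    where
    no-missing : count (missingᵇ G c x {k}) ≡ 0
    no-missing = +-cancelˡ-≡ (deg G x) _ 0 (trans (deg+missing≡k x) (sym (trans (+-identityʳ _) deg≡k)))

  palette-all-but-one : ∀ x → suc (deg G x) ≡ k → ∀ μ → μ < k → ¬ InPalette G c x μ →
    ∀ γ → γ < k → γ ≢ μ → InPalette G c x γ
  palette-all-but-one x 1+deg≡k μ μ<k μ∉ γ γ<k γ≢μ = subst (InPalette G c x) (toℕ-fromℕ< γ<k)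
    (missingᵇ-false G c x γ′ only-μ-missing)
    where
    μ′ γ′ : Fin k
    μ′ = fromℕ< μ<k
    γ′ = fromℕ< γ<k
    μ′-missing : missingᵇ G c x μ′ ≡ true
    μ′-missing with inPalette? G c x (toℕ μ′)
    ... | yes ∈ = contradiction (subst (InPalette G c x) (toℕ-fromℕ< μ<k) ∈) μ∉
    ... | no _ = refl
    one-missing : count (missingᵇ G c x {k}) ≡ 1
    one-missing = +-cancelˡ-≡ (deg G x) _ 1 (trans (deg+missing≡k x) (sym (trans (+-comm (deg G x) 1) 1+deg≡k)))
    γ′≢μ′ : γ′ ≢ μ′
    γ′≢μ′ eq = γ≢μ (trans (sym (toℕ-fromℕ< γ<k)) (trans (cong toℕ eq) (toℕ-fromℕ< μ<k)))
    only-μ-missing : missingᵇ G c x γ′ ≡ false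
    only-μ-missing with count≡0⇒false (missingᵇ G c x ─ μ′)
      (suc-injective (trans (sym (count-─ (missingᵇ G c x) μ′ μ′-missing)) one-missing)) γ′
    ... | γ′-not-left rewrite dec-false (γ′ ≟ μ′) γ′≢μ′ = trans (sym (∧-identityʳ _)) γ′-not-left

-- Alternating paths and Kempe changes
module Orbit {A : Set} (f : A → Maybe A)
  (f-injective : ∀ {x y z} → f x ≡ just z → f y ≡ just z → x ≡ y)
  (x₀ : A) (x₀-initial : ∀ x → f x ≢ just x₀) where

  orbit : ℕ → Maybe A
  orbit zero = just x₀
  orbit (suc s) = orbit s >>= f

  orbit-suc : ∀ s {x} → orbit s ≡ just x → orbit (suc s) ≡ f x
  orbit-suc s eq rewrite eq = refl

  orbit-pred : ∀ s {y} → orbit (suc s) ≡ just y → ∃ λ x → orbit s ≡ just x × f x ≡ just y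
  orbit-pred s eq with orbit s
  ... | just x = x , refl , eq

  orbit-injective : ∀ s t {x} → orbit s ≡ just x → orbit t ≡ just x → s ≡ t
  orbit-injective zero zero _ _ = refl
  orbit-injective zero (suc t) refl eq with orbit-pred t eq
  ... | y , _ , fy≡x₀ = contradiction fy≡x₀ (x₀-initial y)
  orbit-injective (suc s) zero eq refl with orbit-pred s eq
  ... | y , _ , fy≡x₀ = contradiction fy≡x₀ (x₀-initial y)
  orbit-injective (suc s) (suc t) eq eq′ with orbit-pred s eq | orbit-pred t eq′
  ... | y , os , fy | y′ , ot , fy′ rewrite f-injective fy fy′ = cong suc (orbit-injective s t os ot)

  orbit-prefix : ∀ s t {y} → s ≤ t → orbit t ≡ just y → ∃ λ x → orbit s ≡ just x
  orbit-prefix s t s≤t ot with m≤n⇒m<n∨m≡n s≤t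
  ... | inj₂ refl = _ , ot
  orbit-prefix s (suc t) _ ot | inj₁ s<1+t = orbit-prefix s t (s≤s⁻¹ s<1+t) (proj₁ (proj₂ (orbit-pred t ot)))

  module _ {N} (encode : A → Fin N) (encode-injective : ∀ {x y} → encode x ≡ encode y → x ≡ y) where

    orbit-bounded : ∀ s {x} → orbit s ≡ just x → s < N
    orbit-bounded s os = ≰⇒> λ N≤s → no-repetition (pigeonhole (s≤s N≤s) (encode ∘ point))
      where
      point : Fin (suc s) → A
      point i = proj₁ (orbit-prefix (toℕ i) s (s≤s⁻¹ (toℕ<n i)) os)
      point-spec : ∀ i → orbit (toℕ i) ≡ just (point i)
      point-spec i = proj₂ (orbit-prefix (toℕ i) s (s≤s⁻¹ (toℕ<n i)) os)
      no-repetition : ¬ ∃₂ λ i j → i Fin.< j × encode (point i) ≡ encode (point j)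
      no-repetition (i , j , i<j , same) = <⇒≢ i<j (orbit-injective (toℕ i) (toℕ j) (point-spec i)
        (subst (λ z → orbit (toℕ j) ≡ just z) (sym (encode-injective same)) (point-spec j)))

-- A state (x , p) is the current vertex together with the partial involution to follow next: b if p,
-- a otherwise. As a u = nothing, the orbit of (u , true) traces the maximal alternating path from u.
module AlternatingWalk {m} (a b : Fin m → Maybe (Fin m))
  (a-sym : ∀ {x y} → a x ≡ just y → a y ≡ just x) (b-sym : ∀ {x y} → b x ≡ just y → b y ≡ just x)
  (u : Fin m) (a-u : a u ≡ nothing) where

  follow : Bool → Fin m → Maybe (Fin m)
  follow true = b
  follow false = a

  follow-sym : ∀ p {x y} → follow p x ≡ just y → follow p y ≡ just x
  follow-sym true = b-sym
  follow-sym false = a-sym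

  next : Fin m × Bool → Maybe (Fin m × Bool)
  next (x , p) = Maybe.map (_, not p) (follow p x)

  next-just : ∀ {x p y q} → next (x , p) ≡ just (y , q) → follow p x ≡ just y × q ≡ not p
  next-just {x} {p} eq with follow p x
  ... | just _ with refl ← eq = refl , refl

  next-injective : ∀ {s s′ t} → next s ≡ just t → next s′ ≡ just t → s ≡ s′
  next-injective {x , p} {x′ , p′} {y , q} eq eq′ with next-just eq | next-just eq′
  ... | px , q≡¬p | px′ , q≡¬p′ with refl ← not-injective {p} {p′} (trans (sym q≡¬p) q≡¬p′)
    = cong (_, p) (just-injective (trans (sym (follow-sym p px)) (follow-sym p px′)))

  start-initial : ∀ s → next s ≢ just (u , true)
  start-initial (x , true) eq with next-just {x} {true} eq
  ... | _ , ()
  start-initial (x , false) eq with next-just {x} {false} eq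
  ... | ax≡u , _ = contradiction (trans (sym a-u) (a-sym ax≡u)) λ ()

  bit : Bool → Fin 2
  bit false = zero
  bit true = suc zero

  bit-injective : ∀ {p q} → bit p ≡ bit q → p ≡ q
  bit-injective {false} {false} _ = refl
  bit-injective {true} {true} _ = refl

  encode : Fin m × Bool → Fin (m * 2)
  encode (x , p) = combine x (bit p)

  encode-injective : ∀ {s t} → encode s ≡ encode t → s ≡ t
  encode-injective {x , p} {y , q} eq with refl ← combine-injectiveˡ x (bit p) y (bit q) eq
    = cong (x ,_) (bit-injective (combine-injectiveʳ x (bit p) y (bit q) eq))

  open Orbit next next-injective (u , true) start-initial

  OnWalk : Fin m → Set
  OnWalk x = ∃ λ s → ∃ λ p → orbit s ≡ just (x , p)

  onWalk? : ∀ x → Dec (OnWalk x)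
  onWalk? x = Dec.map′ (λ (s , _ , at) → s , at) (λ (s , p , at) → s , orbit-bounded encode encode-injective s at , p , at)
    (anyUpTo? (at? x) (m * 2))
    where
    at? : ∀ x s → Dec (∃ λ p → orbit s ≡ just (x , p))
    at? x s with orbit s
    ... | nothing = no λ ()
    ... | just (y , p) = Dec.map′ (λ { refl → p , refl }) (λ { (_ , refl) → refl }) (y ≟ x)

  onWalk-start : OnWalk u
  onWalk-start = 0 , true , refl

  onWalk-entered : ∀ s p {x y} → orbit s ≡ just (x , not p) → follow p x ≡ just y → OnWalk y
  onWalk-entered zero false refl px = contradiction (trans (sym a-u) px) λ ()
  onWalk-entered (suc s) p os px with orbit-pred s os
  ... | (x₀ , q₀) , os₀ , nx₀ with next-just nx₀
  ... | sx₀ , ¬p≡¬q₀ with refl ← not-injective {p} {q₀} ¬p≡¬q₀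
    = s , p , subst (λ z → orbit s ≡ just (z , p)) (just-injective (trans (sym (follow-sym p sx₀)) px)) os₀

  onWalk-follow : ∀ p {x y} → OnWalk x → follow p x ≡ just y → OnWalk y
  onWalk-follow p {x} (s , q , os) px with q Bool.≟ p
  ... | yes refl = suc s , not p , trans (orbit-suc s os) (cong (Maybe.map (_, not p)) px)
  ... | no q≢p = onWalk-entered s p (subst (λ q → orbit s ≡ just (x , q)) (¬-not q≢p) os) px

  walk-stops : ∀ s {x q} → orbit s ≡ just (x , q) → b x ≡ nothing → orbit (suc s) ≡ nothing
  walk-stops s {q = true} os bx = trans (orbit-suc s os) (cong (Maybe.map _) bx)
  walk-stops (suc s) {x} {false} os bx with orbit-pred s os
  ... | (x₀ , q₀) , _ , nx₀ with next-just nx₀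
  ... | sx₀ , false≡¬q₀ with refl ← not-injective {q₀} {true} (sym false≡¬q₀)
    = contradiction (trans (sym bx) (b-sym sx₀)) λ ()

  walk-end-unique : ∀ {x y} → OnWalk x → OnWalk y → b x ≡ nothing → b y ≡ nothing → x ≡ y
  walk-end-unique (s , p , os) (t , q , ot) bx by with <-cmp s t
  ... | tri< s<t _ _ = contradiction (trans (sym (walk-stops s os bx)) (proj₂ (orbit-prefix (suc s) t s<t ot))) λ ()
  ... | tri≈ _ refl _ = cong proj₁ (just-injective (trans (sym os) ot))
  ... | tri> _ _ t<s = contradiction (trans (sym (walk-stops t ot by)) (proj₂ (orbit-prefix (suc t) s t<s os))) λ ()

module _ {n k} {G : Graph n} {c : EdgeColouring n} (simple : IsSimple G) (col : IsColouring k G c) where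

  partner : ℕ → Fin n → Maybe (Fin n)
  partner γ x with inPalette? G c x γ
  ... | yes (y , _) = just y
  ... | no _ = nothing

  partner-just : ∀ γ {x y} → partner γ x ≡ just y → adj G x y ≡ true × c x y ≡ γ
  partner-just γ {x} eq with inPalette? G c x γ
  ... | yes (_ , xy , cxy) with refl ← eq = xy , cxy

  partner-edge : ∀ γ {x y} → adj G x y ≡ true → c x y ≡ γ → partner γ x ≡ just y
  partner-edge γ {x} {y} xy cxy with inPalette? G c x γ
  ... | yes (y′ , xy′ , cxy′) = cong just (colour-injective col x y′ y xy′ xy (trans cxy′ (sym cxy)))
  ... | no γ∉ = contradiction (y , xy , cxy) γ∉

  partner-missing : ∀ γ {x} → ¬ InPalette G c x γ → partner γ x ≡ nothing
  partner-missing γ {x} γ∉ with inPalette? G c x γ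
  ... | yes γ∈ = contradiction γ∈ γ∉
  ... | no _ = refl

  partner-sym : ∀ γ {x y} → partner γ x ≡ just y → partner γ y ≡ just x
  partner-sym γ {x} {y} eq with partner-just γ eq
  ... | xy , cxy = partner-edge γ (trans (proj₁ simple y x) xy) (trans (sym (colour-sym col x y xy)) cxy)

swap : ℕ → ℕ → ℕ → ℕ
swap α β γ with γ ℕ.≟ α | γ ℕ.≟ β
... | yes _ | _ = β
... | no _ | yes _ = α
... | no _ | no _ = γ

module _ (α β : ℕ) where

  swap-α : swap α β α ≡ β
  swap-α with α ℕ.≟ α
  ... | yes _ = refl
  ... | no α≢α = contradiction refl α≢α

  swap-β : swap α β β ≡ α
  swap-β with β ℕ.≟ α | β ℕ.≟ β
  ... | yes β≡α | _ = β≡α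
  ... | no _ | yes _ = refl
  ... | no _ | no β≢β = contradiction refl β≢β

  swap-other : ∀ {γ} → γ ≢ α → γ ≢ β → swap α β γ ≡ γ
  swap-other {γ} γ≢α γ≢β with γ ℕ.≟ α | γ ℕ.≟ β
  ... | yes γ≡α | _ = contradiction γ≡α γ≢α
  ... | no _ | yes γ≡β = contradiction γ≡β γ≢β
  ... | no _ | no _ = refl

  swap-involutive : ∀ γ → swap α β (swap α β γ) ≡ γ
  swap-involutive γ with γ ℕ.≟ α | γ ℕ.≟ β
  ... | yes refl | _ = swap-β
  ... | no _ | yes refl = swap-α
  ... | no γ≢α | no γ≢β = swap-other γ≢α γ≢β

  swap-injective : ∀ {γ δ} → swap α β γ ≡ swap α β δ → γ ≡ δ
  swap-injective {γ} {δ} eq = trans (sym (swap-involutive γ)) (trans (cong (swap α β) eq) (swap-involutive δ))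

  swap-< : ∀ {k γ} → α < k → β < k → γ < k → swap α β γ < k
  swap-< {γ = γ} α<k β<k γ<k with γ ℕ.≟ α | γ ℕ.≟ β
  ... | yes _ | _ = β<k
  ... | no _ | yes _ = α<k
  ... | no _ | no _ = γ<k

kempeChange : ∀ {n} → (Fin n → Bool) → ℕ → ℕ → EdgeColouring n → EdgeColouring n
kempeChange T α β c x y = if T x then swap α β (c x y) else c x y

module _ {n k} {G : Graph n} {c : EdgeColouring n} (col : IsColouring k G c) {α β} (α<k : α < k) (β<k : β < k)
  (T : Fin n → Bool) (T-closed : ∀ x y → adj G x y ≡ true → c x y ≡ α ⊎ c x y ≡ β → T x ≡ T y) where

  kempeChange-fixes : ∀ x y → c x y ≢ α → c x y ≢ β → kempeChange T α β c x y ≡ c x y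
  kempeChange-fixes x y ≢α ≢β with T x
  ... | true = swap-other α β ≢α ≢β
  ... | false = refl

  kempeChange-injective : ∀ x y z → kempeChange T α β c x y ≡ kempeChange T α β c x z → c x y ≡ c x z
  kempeChange-injective x y z eq with T x
  ... | true = swap-injective α β eq
  ... | false = eq

  kempeChange-isColouring : IsColouring k G (kempeChange T α β c)
  colour-sym kempeChange-isColouring x y xy with (c x y ℕ.≟ α) ⊎-dec (c x y ℕ.≟ β)
  ... | yes α⊎β rewrite T-closed x y xy α⊎β | colour-sym col x y xy = refl
  ... | no ¬α⊎β = trans (kempeChange-fixes x y (¬α⊎β ∘ inj₁) (¬α⊎β ∘ inj₂)) (trans (colour-sym col x y xy)
      (sym (kempeChange-fixes y x (¬α⊎β ∘ inj₁ ∘ trans (colour-sym col x y xy)) (¬α⊎β ∘ inj₂ ∘ trans (colour-sym col x y xy)))))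
  colour-proper kempeChange-isColouring x y z xy xz y≢z eq = colour-proper col x y z xy xz y≢z (kempeChange-injective x y z eq)
  colour-< kempeChange-isColouring x y xy with T x
  ... | true = swap-< α β α<k β<k (colour-< col x y xy)
  ... | false = colour-< col x y xy

  kempeChange-preimage : ∀ x y {γ} → kempeChange T α β c x y ≡ γ → c x y ≡ (if T x then swap α β γ else γ)
  kempeChange-preimage x y eq with T x
  ... | true = trans (sym (swap-involutive α β (c x y))) (cong (swap α β) eq)
  ... | false = eq

  kempeChange-missing-other : ∀ x {γ} → γ ≢ α → γ ≢ β → ¬ InPalette G c x γ → ¬ InPalette G (kempeChange T α β c) x γ
  kempeChange-missing-other x {γ} γ≢α γ≢β γ∉ (y , xy , eq) = γ∉ (y , xy , trans (kempeChange-preimage x y eq) (fixed (T x)))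
    where
    fixed : ∀ b → (if b then swap α β γ else γ) ≡ γ
    fixed true = swap-other α β γ≢α γ≢β
    fixed false = refl

  kempeChange-missing-outside : ∀ x {γ} → T x ≡ false → ¬ InPalette G c x γ → ¬ InPalette G (kempeChange T α β c) x γ
  kempeChange-missing-outside x {γ} Tx γ∉ (y , xy , eq) =
    γ∉ (y , xy , trans (kempeChange-preimage x y eq) (cong (λ b → if b then swap α β γ else γ) Tx))

  kempeChange-missing-swapped : ∀ x → T x ≡ true → ¬ InPalette G c x β → ¬ InPalette G (kempeChange T α β c) x α
  kempeChange-missing-swapped x Tx β∉ (y , xy , eq) =
    β∉ (y , xy , trans (kempeChange-preimage x y eq) (trans (cong (λ b → if b then swap α β α else α) Tx) (swap-α α β)))

  kempeChange-outside : ∀ x y → T x ≡ false → kempeChange T α β c x y ≡ c x y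
  kempeChange-outside x y Tx rewrite Tx = refl

-- Vizing fans
isArc : ∀ {n} → Fin n → Fin n → Fin n → Fin n → Bool
isArc u v x y with x ≟ u | y ≟ v
... | yes _ | yes _ = true
... | _ | _ = false

addEdge : ∀ {n} → Graph n → Fin n → Fin n → Graph n
addEdge G u v = record { adj = λ x y → adj G x y ∨ (isArc u v x y ∨ isArc u v y x) }

module _ {n} (G : Graph n) (u v : Fin n) where

  addEdge-cases : ∀ x y → adj (addEdge G u v) x y ≡ true →
    adj G x y ≡ true ⊎ (x ≡ u × y ≡ v) ⊎ (x ≡ v × y ≡ u)
  addEdge-cases x y xy with adj G x y | x ≟ u | y ≟ v | y ≟ u | x ≟ v
  ... | true | _ | _ | _ | _ = inj₁ refl
  ... | false | yes x≡u | yes y≡v | _ | _ = inj₂ (inj₁ (x≡u , y≡v))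
  ... | false | _ | _ | yes y≡u | yes x≡v = inj₂ (inj₂ (x≡v , y≡u))
  ... | false | no _ | _ | no _ | _ = contradiction xy λ ()
  ... | false | no _ | _ | yes _ | no _ = contradiction xy λ ()
  ... | false | yes _ | no _ | no _ | _ = contradiction xy λ ()
  ... | false | yes _ | no _ | yes _ | no _ = contradiction xy λ ()

  addEdge-old : ∀ x y → adj G x y ≡ true → adj (addEdge G u v) x y ≡ true
  addEdge-old x y xy rewrite xy = refl

  addEdge-new : adj (addEdge G u v) u v ≡ true
  addEdge-new with u ≟ u | v ≟ v
  ... | yes _ | yes _ = ∨-zeroʳ (adj G u v)
  ... | no u≢u | _ = contradiction refl u≢u
  ... | yes _ | no v≢v = contradiction refl v≢v

  addEdge-simple : IsSimple G → u ≢ v → IsSimple (addEdge G u v)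
  addEdge-simple (G-sym , G-irrefl) u≢v = sym′ , irrefl′
    where
    sym′ : ∀ x y → adj (addEdge G u v) x y ≡ adj (addEdge G u v) y x
    sym′ x y rewrite G-sym x y = cong (adj G y x ∨_) (∨-comm (isArc u v x y) (isArc u v y x))
    irrefl′ : ∀ x → adj (addEdge G u v) x x ≡ false
    irrefl′ x with adj (addEdge G u v) x x in xx
    ... | false = refl
    ... | true with addEdge-cases x x xx
    ...   | inj₁ xx′ = trans (sym xx′) (G-irrefl x)
    ...   | inj₂ (inj₁ (refl , refl)) = contradiction refl u≢v
    ...   | inj₂ (inj₂ (refl , refl)) = contradiction refl u≢v

_[_≔_] : ∀ {A : Set} → (ℕ → A) → ℕ → A → ℕ → A
(f [ i ≔ a ]) l with l ℕ.≟ i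
... | yes _ = a
... | no _ = f l

module _ {A : Set} (f : ℕ → A) (i : ℕ) (a : A) where

  update-same : (f [ i ≔ a ]) i ≡ a
  update-same with i ℕ.≟ i
  ... | yes _ = refl
  ... | no i≢i = contradiction refl i≢i

  update-other : ∀ l → l ≢ i → (f [ i ≔ a ]) l ≡ f l
  update-other l l≢i with l ℕ.≟ i
  ... | yes l≡i = contradiction l≡i l≢i
  ... | no _ = refl

InFan : ∀ {n} → ℕ → (ℕ → Fin n) → Fin n → Set
InFan ℓ vs y = ∃ λ l → l < suc ℓ × vs l ≡ y

inFan? : ∀ {n} ℓ (vs : ℕ → Fin n) y → Dec (InFan ℓ vs y)
inFan? ℓ vs y = anyUpTo? (λ l → vs l ≟ y) (suc ℓ)

-- A Vizing fan at u for the uncoloured edge uv; only the values of vs and bs at indices ≤ ℓ matter.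
record Fan {n} (k : ℕ) (G : Graph n) (c : EdgeColouring n) (u v : Fin n)
           (ℓ : ℕ) (vs : ℕ → Fin n) (bs : ℕ → ℕ) : Set where
  field
    fan-start : vs 0 ≡ v
    fan-spoke : ∀ l → l < ℓ → adj G u (vs (suc l)) ≡ true
    fan-colour : ∀ l → l < ℓ → c u (vs (suc l)) ≡ bs l
    fan-missing : ∀ l → l ≤ ℓ → ¬ InPalette G c (vs l) (bs l)
    fan-injective : ∀ l l′ → l ≤ ℓ → l′ ≤ ℓ → vs l ≡ vs l′ → l ≡ l′
    fan-< : ∀ l → l ≤ ℓ → bs l < k
open Fan public

module _ {n k} {G : Graph n} {c : EdgeColouring n} {u v : Fin n} {ℓ vs bs} (fan : Fan k G c u v ℓ vs bs) where

  fan-colour-present : ∀ l → l < ℓ → InPalette G c u (bs l)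
  fan-colour-present l l<ℓ = vs (suc l) , fan-spoke fan l l<ℓ , fan-colour fan l l<ℓ

  extend-fan : ∀ w γ → adj G u w ≡ true → c u w ≡ bs ℓ → ¬ InFan ℓ vs w → γ < k → ¬ InPalette G c w γ →
    Fan k G c u v (suc ℓ) (vs [ suc ℓ ≔ w ]) (bs [ suc ℓ ≔ γ ])
  extend-fan w γ uw cuw w∉ γ<k γ∉ = record
    { fan-start = trans (update-other vs (suc ℓ) w 0 λ ()) (fan-start fan)
    ; fan-spoke = spoke
    ; fan-colour = colour
    ; fan-missing = missing
    ; fan-injective = injective
    ; fan-< = bounded
    }
    where
    vs′ : ℕ → Fin n
    vs′ = vs [ suc ℓ ≔ w ]
    bs′ : ℕ → ℕ
    bs′ = bs [ suc ℓ ≔ γ ]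
    old-vs : ∀ l → l ≤ ℓ → vs′ l ≡ vs l
    old-vs l l≤ℓ = update-other vs (suc ℓ) w l (<⇒≢ (s≤s l≤ℓ))
    old-bs : ∀ l → l ≤ ℓ → bs′ l ≡ bs l
    old-bs l l≤ℓ = update-other bs (suc ℓ) γ l (<⇒≢ (s≤s l≤ℓ))
    spoke : ∀ l → l < suc ℓ → adj G u (vs′ (suc l)) ≡ true
    spoke l l<1+ℓ with m≤n⇒m<n∨m≡n (s≤s⁻¹ l<1+ℓ)
    ... | inj₁ l<ℓ = subst (λ y → adj G u y ≡ true) (sym (old-vs (suc l) l<ℓ)) (fan-spoke fan l l<ℓ)
    ... | inj₂ refl = subst (λ y → adj G u y ≡ true) (sym (update-same vs (suc l) w)) uw
    colour : ∀ l → l < suc ℓ → c u (vs′ (suc l)) ≡ bs′ l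
    colour l l<1+ℓ with m≤n⇒m<n∨m≡n (s≤s⁻¹ l<1+ℓ)
    ... | inj₁ l<ℓ = subst₂ (λ y β → c u y ≡ β) (sym (old-vs (suc l) l<ℓ)) (sym (old-bs l (<⇒≤ l<ℓ))) (fan-colour fan l l<ℓ)
    ... | inj₂ refl = subst₂ (λ y β → c u y ≡ β) (sym (update-same vs (suc l) w)) (sym (old-bs l ≤-refl)) cuw
    missing : ∀ l → l ≤ suc ℓ → ¬ InPalette G c (vs′ l) (bs′ l)
    missing l l≤1+ℓ with m≤n⇒m<n∨m≡n l≤1+ℓ
    ... | inj₁ l<1+ℓ = subst₂ (λ y β → ¬ InPalette G c y β) (sym (old-vs l (s≤s⁻¹ l<1+ℓ))) (sym (old-bs l (s≤s⁻¹ l<1+ℓ)))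
                         (fan-missing fan l (s≤s⁻¹ l<1+ℓ))
    ... | inj₂ refl = subst₂ (λ y β → ¬ InPalette G c y β) (sym (update-same vs l w)) (sym (update-same bs l γ)) γ∉
    injective : ∀ l l′ → l ≤ suc ℓ → l′ ≤ suc ℓ → vs′ l ≡ vs′ l′ → l ≡ l′
    injective l l′ l≤ l′≤ eq with m≤n⇒m<n∨m≡n l≤ | m≤n⇒m<n∨m≡n l′≤
    ... | inj₁ l< | inj₁ l′< = fan-injective fan l l′ (s≤s⁻¹ l<) (s≤s⁻¹ l′<)
                                 (trans (sym (old-vs l (s≤s⁻¹ l<))) (trans eq (old-vs l′ (s≤s⁻¹ l′<))))
    ... | inj₁ l< | inj₂ refl = contradiction (l , l< , trans (sym (old-vs l (s≤s⁻¹ l<))) (trans eq (update-same vs l′ w))) w∉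
    ... | inj₂ refl | inj₁ l′< = contradiction (l′ , l′< , trans (sym (old-vs l′ (s≤s⁻¹ l′<))) (trans (sym eq) (update-same vs l w))) w∉
    ... | inj₂ refl | inj₂ refl = refl
    bounded : ∀ l → l ≤ suc ℓ → bs′ l < k
    bounded l l≤1+ℓ with m≤n⇒m<n∨m≡n l≤1+ℓ
    ... | inj₁ l<1+ℓ = subst (_< k) (sym (old-bs l (s≤s⁻¹ l<1+ℓ))) (fan-< fan l (s≤s⁻¹ l<1+ℓ))
    ... | inj₂ refl = subst (_< k) (sym (update-same bs l γ)) γ<k

  restrict-fan : ∀ {c′} i α → i ≤ ℓ → α < k →
    (∀ l → l < i → c′ u (vs (suc l)) ≡ c u (vs (suc l))) →
    (∀ l → l < i → ¬ InPalette G c′ (vs l) (bs l)) → ¬ InPalette G c′ (vs i) α →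
    Fan k G c′ u v i vs (bs [ i ≔ α ])
  restrict-fan {c′} i α i≤ℓ α<k spokes-kept missing-kept α∉ = record
    { fan-start = fan-start fan
    ; fan-spoke = λ l l<i → fan-spoke fan l (≤-trans l<i i≤ℓ)
    ; fan-colour = λ l l<i → trans (spokes-kept l l<i)
        (trans (fan-colour fan l (≤-trans l<i i≤ℓ)) (sym (update-other bs i α l (<⇒≢ l<i))))
    ; fan-missing = missing
    ; fan-injective = λ l l′ l≤i l′≤i → fan-injective fan l l′ (≤-trans l≤i i≤ℓ) (≤-trans l′≤i i≤ℓ)
    ; fan-< = bounded
    }
    where
    missing : ∀ l → l ≤ i → ¬ InPalette G c′ (vs l) ((bs [ i ≔ α ]) l)
    missing l l≤i with m≤n⇒m<n∨m≡n l≤i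
    ... | inj₁ l<i = subst (¬_ ∘ InPalette G c′ (vs l)) (sym (update-other bs i α l (<⇒≢ l<i))) (missing-kept l l<i)
    ... | inj₂ refl = subst (¬_ ∘ InPalette G c′ (vs l)) (sym (update-same bs l α)) α∉
    bounded : ∀ l → l ≤ i → (bs [ i ≔ α ]) l < k
    bounded l l≤i with m≤n⇒m<n∨m≡n l≤i
    ... | inj₁ l<i = subst (_< k) (sym (update-other bs i α l (<⇒≢ l<i))) (fan-< fan l (≤-trans l≤i i≤ℓ))
    ... | inj₂ refl = subst (_< k) (sym (update-same bs l α)) α<k

module _ {n k} {G : Graph n} {c : EdgeColouring n} (col : IsColouring k G c) {u v : Fin n}
         {ℓ vs bs} (fan : Fan k G c u v ℓ vs bs) where

  fan-colours-injective : ∀ l l′ → l < ℓ → l′ < ℓ → bs l ≡ bs l′ → l ≡ l′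
  fan-colours-injective l l′ l<ℓ l′<ℓ eq = cong pred (fan-injective fan (suc l) (suc l′) l<ℓ l′<ℓ
    (colour-injective col u _ _ (fan-spoke fan l l<ℓ) (fan-spoke fan l′ l′<ℓ)
      (trans (fan-colour fan l l<ℓ) (trans eq (sym (fan-colour fan l′ l′<ℓ))))))

  fan-length : ℓ < n
  fan-length = ≰⇒> λ n≤ℓ → no-repetition (pigeonhole (s≤s n≤ℓ) (vs ∘ toℕ))
    where
    no-repetition : ¬ ∃₂ λ i j → i Fin.< j × vs (toℕ i) ≡ vs (toℕ j)
    no-repetition (i , j , i<j , same) = <⇒≢ i<j
      (fan-injective fan (toℕ i) (toℕ j) (s≤s⁻¹ (toℕ<n i)) (s≤s⁻¹ (toℕ<n j)) same)

-- Shifting the fan, u (vs l) gets colour bs l for every l ≤ ℓ; in particular uv = u (vs 0) is coloured.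
-- This stays proper because bs l is missing at vs l and bs ℓ is missing at u.
module Rotation {n k} {G : Graph n} {c : EdgeColouring n} (simple : IsSimple G) (col : IsColouring k G c)
  {u v : Fin n} (u≢v : u ≢ v) (¬uv : adj G u v ≡ false)
  {ℓ vs bs} (fan : Fan k G c u v ℓ vs bs) (last-missing : ¬ InPalette G c u (bs ℓ)) where

  G′ : Graph n
  G′ = addEdge G u v

  spokeColour : Fin n → ℕ
  spokeColour y with inFan? ℓ vs y
  ... | yes (l , _ , _) = bs l
  ... | no _ = c u y

  rotated : EdgeColouring n
  rotated x y with x ≟ u | y ≟ u
  ... | yes _ | _ = spokeColour y
  ... | no _ | yes _ = spokeColour x
  ... | no _ | no _ = c x y

  rotated-from-u : ∀ {x} y → x ≡ u → rotated x y ≡ spokeColour y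
  rotated-from-u {x} y refl with x ≟ x
  ... | yes _ = refl
  ... | no x≢x = contradiction refl x≢x

  rotated-to-u : ∀ x {y} → x ≢ u → y ≡ u → rotated x y ≡ spokeColour x
  rotated-to-u x {y} x≢u refl with x ≟ y | y ≟ y
  ... | yes x≡u | _ = contradiction x≡u x≢u
  ... | no _ | yes _ = refl
  ... | no _ | no y≢y = contradiction refl y≢y

  rotated-away : ∀ x y → x ≢ u → y ≢ u → rotated x y ≡ c x y
  rotated-away x y x≢u y≢u with x ≟ u | y ≟ u
  ... | yes x≡u | _ = contradiction x≡u x≢u
  ... | no _ | yes y≡u = contradiction y≡u y≢u
  ... | no _ | no _ = refl

  spoke-in-G : ∀ y → ¬ InFan ℓ vs y → adj G′ u y ≡ true → adj G u y ≡ true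
  spoke-in-G y ∉ uy with addEdge-cases G u v u y uy
  ... | inj₁ uy′ = uy′
  ... | inj₂ (inj₁ (_ , refl)) = contradiction (0 , s≤s z≤n , fan-start fan) ∉
  ... | inj₂ (inj₂ (u≡v , _)) = contradiction u≡v u≢v

  away-in-G : ∀ x y → x ≢ u → y ≢ u → adj G′ x y ≡ true → adj G x y ≡ true
  away-in-G x y x≢u y≢u xy with addEdge-cases G u v x y xy
  ... | inj₁ xy′ = xy′
  ... | inj₂ (inj₁ (x≡u , _)) = contradiction x≡u x≢u
  ... | inj₂ (inj₂ (_ , y≡u)) = contradiction y≡u y≢u

  G′-simple : IsSimple G′
  G′-simple = addEdge-simple G u v simple u≢v

  fan-colours-distinct : ∀ l l′ → l ≤ ℓ → l′ ≤ ℓ → l ≢ l′ → bs l ≢ bs l′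
  fan-colours-distinct l l′ l≤ℓ l′≤ℓ l≢l′ eq with m≤n⇒m<n∨m≡n l≤ℓ | m≤n⇒m<n∨m≡n l′≤ℓ
  ... | inj₁ l<ℓ | inj₁ l′<ℓ = l≢l′ (fan-colours-injective col fan l l′ l<ℓ l′<ℓ eq)
  ... | inj₁ l<ℓ | inj₂ refl = last-missing (subst (InPalette G c u) eq (fan-colour-present fan l l<ℓ))
  ... | inj₂ refl | inj₁ l′<ℓ = last-missing (subst (InPalette G c u) (sym eq) (fan-colour-present fan l′ l′<ℓ))
  ... | inj₂ refl | inj₂ refl = l≢l′ refl

  fan-colour-fresh : ∀ l z → l ≤ ℓ → ¬ InFan ℓ vs z → adj G u z ≡ true → bs l ≢ c u z
  fan-colour-fresh l z l≤ℓ ∉ uz eq with m≤n⇒m<n∨m≡n l≤ℓ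
  ... | inj₁ l<ℓ = colour-proper col u (vs (suc l)) z (fan-spoke fan l l<ℓ) uz
                     (λ vs≡z → ∉ (suc l , s≤s l<ℓ , vs≡z)) (trans (fan-colour fan l l<ℓ) eq)
  ... | inj₂ refl = last-missing (z , uz , sym eq)

  spoke-colours-distinct : ∀ y z → adj G′ u y ≡ true → adj G′ u z ≡ true → y ≢ z → spokeColour y ≢ spokeColour z
  spoke-colours-distinct y z uy uz y≢z with inFan? ℓ vs y | inFan? ℓ vs z
  ... | yes (l , l< , refl) | yes (l′ , l′< , refl) =
    fan-colours-distinct l l′ (s≤s⁻¹ l<) (s≤s⁻¹ l′<) (λ l≡l′ → y≢z (cong vs l≡l′))
  ... | yes (l , l< , refl) | no z∉ =
    fan-colour-fresh l z (s≤s⁻¹ l<) z∉ (spoke-in-G z z∉ uz)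
  ... | no y∉ | yes (l′ , l′< , refl) =
    fan-colour-fresh l′ y (s≤s⁻¹ l′<) y∉ (spoke-in-G y y∉ uy) ∘ sym
  ... | no y∉ | no z∉ =
    colour-proper col u y z (spoke-in-G y y∉ uy) (spoke-in-G z z∉ uz) y≢z

  spoke-colour-fresh : ∀ x z → adj G′ u x ≡ true → z ≢ u → adj G x z ≡ true → spokeColour x ≢ c x z
  spoke-colour-fresh x z ux z≢u xz with inFan? ℓ vs x
  ... | yes (l , l< , refl) =
    λ eq → fan-missing fan l (s≤s⁻¹ l<) (z , xz , sym eq)
  ... | no x∉ =
    λ eq → colour-proper col x u z (trans (proj₁ simple x u) ux′) xz (z≢u ∘ sym)
             (trans (sym (colour-sym col u x ux′)) eq)
    where
    ux′ : adj G u x ≡ true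
    ux′ = spoke-in-G x x∉ ux

  spoke-colour-< : ∀ y → adj G′ u y ≡ true → spokeColour y < k
  spoke-colour-< y uy with inFan? ℓ vs y
  ... | yes (l , l< , refl) = fan-< fan l (s≤s⁻¹ l<)
  ... | no y∉ = colour-< col u y (spoke-in-G y y∉ uy)

  G′-irrefl : ∀ {x y} → adj G′ x y ≡ true → x ≢ y
  G′-irrefl {x} xy refl with () ← trans (sym xy) (proj₂ G′-simple x)

  rotated-sym : ∀ x y → adj G′ x y ≡ true → Dec (x ≡ u) → Dec (y ≡ u) → rotated x y ≡ rotated y x
  rotated-sym x y xy (yes x≡u) (yes y≡u) = contradiction (trans x≡u (sym y≡u)) (G′-irrefl xy)
  rotated-sym x y xy (yes x≡u) (no y≢u) = trans (rotated-from-u y x≡u) (sym (rotated-to-u y y≢u x≡u))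
  rotated-sym x y xy (no x≢u) (yes y≡u) = trans (rotated-to-u x x≢u y≡u) (sym (rotated-from-u x y≡u))
  rotated-sym x y xy (no x≢u) (no y≢u) = trans (rotated-away x y x≢u y≢u)
    (trans (colour-sym col x y (away-in-G x y x≢u y≢u xy)) (sym (rotated-away y x y≢u x≢u)))

  rotated-proper : ∀ x y z → adj G′ x y ≡ true → adj G′ x z ≡ true → y ≢ z →
    Dec (x ≡ u) → Dec (y ≡ u) → Dec (z ≡ u) → rotated x y ≢ rotated x z
  rotated-proper x y z xy xz y≢z (yes refl) _ _ eq =
    spoke-colours-distinct y z xy xz y≢z (trans (sym (rotated-from-u y refl)) (trans eq (rotated-from-u z refl)))
  rotated-proper x y z xy xz y≢z (no x≢u) (yes y≡u) (yes z≡u) eq = y≢z (trans y≡u (sym z≡u))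
  rotated-proper x y z xy xz y≢z (no x≢u) (yes refl) (no z≢u) eq =
    spoke-colour-fresh x z (trans (proj₁ G′-simple u x) xy) z≢u (away-in-G x z x≢u z≢u xz)
      (trans (sym (rotated-to-u x x≢u refl)) (trans eq (rotated-away x z x≢u z≢u)))
  rotated-proper x y z xy xz y≢z (no x≢u) (no y≢u) (yes refl) eq =
    spoke-colour-fresh x y (trans (proj₁ G′-simple u x) xz) y≢u (away-in-G x y x≢u y≢u xy)
      (trans (sym (rotated-to-u x x≢u refl)) (trans (sym eq) (rotated-away x y x≢u y≢u)))
  rotated-proper x y z xy xz y≢z (no x≢u) (no y≢u) (no z≢u) eq =
    colour-proper col x y z (away-in-G x y x≢u y≢u xy) (away-in-G x z x≢u z≢u xz) y≢z
      (trans (sym (rotated-away x y x≢u y≢u)) (trans eq (rotated-away x z x≢u z≢u)))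

  rotated-< : ∀ x y → adj G′ x y ≡ true → Dec (x ≡ u) → Dec (y ≡ u) → rotated x y < k
  rotated-< x y xy (yes refl) _ = subst (_< k) (sym (rotated-from-u y refl)) (spoke-colour-< y xy)
  rotated-< x y xy (no x≢u) (yes refl) =
    subst (_< k) (sym (rotated-to-u x x≢u refl)) (spoke-colour-< x (trans (proj₁ G′-simple u x) xy))
  rotated-< x y xy (no x≢u) (no y≢u) =
    subst (_< k) (sym (rotated-away x y x≢u y≢u)) (colour-< col x y (away-in-G x y x≢u y≢u xy))

  rotated-isColouring : IsColouring k G′ rotated
  colour-sym rotated-isColouring x y xy = rotated-sym x y xy (x ≟ u) (y ≟ u)
  colour-proper rotated-isColouring x y z xy xz y≢z = rotated-proper x y z xy xz y≢z (x ≟ u) (y ≟ u) (z ≟ u)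
  colour-< rotated-isColouring x y xy = rotated-< x y xy (x ≟ u) (y ≟ u)

module Extension {n k} {G : Graph n} (simple : IsSimple G) (deg< : ∀ x → deg G x < k)
  {u v : Fin n} (u≢v : u ≢ v) (¬uv : adj G u v ≡ false) where

  Extended : Set
  Extended = ∃ λ c′ → IsColouring k (addEdge G u v) c′

  rotate : ∀ {c ℓ vs bs} → IsColouring k G c → Fan k G c u v ℓ vs bs → ¬ InPalette G c u (bs ℓ) → Extended
  rotate col fan last-missing = rotated , rotated-isColouring
    where open Rotation simple col u≢v ¬uv fan last-missing

  -- α is missing at u, while β = bs j = bs ℓ is not. Switching α and β off the α/β-path starting at u
  -- leaves the colours at u alone. At most one vertex of that path misses β, so vs j or vs ℓ lies off it
  -- and misses α afterwards; cutting the fan there and ending it with α makes it rotatable.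
  module KempeCase {c} (col : IsColouring k G c) {ℓ vs bs} (fan : Fan k G c u v ℓ vs bs)
    (j : ℕ) (j<ℓ : j < ℓ) (bsj≡bsℓ : bs j ≡ bs ℓ) {α} (α<k : α < k) (α∉u : ¬ InPalette G c u α) where

    β : ℕ
    β = bs ℓ
    β<k : β < k
    β<k = fan-< fan ℓ ≤-refl

    open AlternatingWalk (partner simple col α) (partner simple col β) (partner-sym simple col α) (partner-sym simple col β)
      u (partner-missing simple col α α∉u)

    onWalk-edge : ∀ {x y} → OnWalk x → adj G x y ≡ true → c x y ≡ α ⊎ c x y ≡ β → OnWalk y
    onWalk-edge on xy (inj₁ cxy≡α) = onWalk-follow false on (partner-edge simple col α xy cxy≡α)
    onWalk-edge on xy (inj₂ cxy≡β) = onWalk-follow true on (partner-edge simple col β xy cxy≡β)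

    offWalk : Fin n → Bool
    offWalk x = not (does (onWalk? x))

    offWalk-closed : ∀ x y → adj G x y ≡ true → c x y ≡ α ⊎ c x y ≡ β → offWalk x ≡ offWalk y
    offWalk-closed x y xy αβ = cong not (does-⇔ (mk⇔ (λ on → onWalk-edge on xy αβ)
      (λ on → onWalk-edge on yx (Sum.map (trans (sym cxy≡cyx)) (trans (sym cxy≡cyx)) αβ))) (onWalk? x) (onWalk? y))
      where
      yx : adj G y x ≡ true
      yx = trans (proj₁ simple y x) xy
      cxy≡cyx : c x y ≡ c y x
      cxy≡cyx = colour-sym col x y xy

    c′ : EdgeColouring n
    c′ = kempeChange offWalk α β c

    col′ : IsColouring k G c′
    col′ = kempeChange-isColouring col α<k β<k offWalk offWalk-closed

    onWalk⇒offWalk≡false : ∀ {x} → OnWalk x → offWalk x ≡ false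
    onWalk⇒offWalk≡false {x} on = cong not (dec-true (onWalk? x) on)

    ¬onWalk⇒offWalk≡true : ∀ {x} → ¬ OnWalk x → offWalk x ≡ true
    ¬onWalk⇒offWalk≡true {x} off = cong not (dec-false (onWalk? x) off)

    missing-kept : ∀ l → l < ℓ → l ≢ j ⊎ OnWalk (vs l) → ¬ InPalette G c′ (vs l) (bs l)
    missing-kept l l<ℓ (inj₂ on) = kempeChange-missing-outside col α<k β<k offWalk offWalk-closed (vs l)
      (onWalk⇒offWalk≡false on) (fan-missing fan l (<⇒≤ l<ℓ))
    missing-kept l l<ℓ (inj₁ l≢j) = kempeChange-missing-other col α<k β<k offWalk offWalk-closed (vs l)
      (λ bsl≡α → α∉u (subst (InPalette G c u) bsl≡α (fan-colour-present fan l l<ℓ)))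
      (λ bsl≡β → l≢j (fan-colours-injective col fan l j l<ℓ j<ℓ (trans bsl≡β (sym bsj≡bsℓ))))
      (fan-missing fan l (<⇒≤ l<ℓ))

    rotate-at : ∀ i → i ≤ ℓ → ¬ OnWalk (vs i) → bs i ≡ β → (∀ l → l < i → ¬ InPalette G c′ (vs l) (bs l)) → Extended
    rotate-at i i≤ℓ off bsi≡β kept = rotate col′
      (restrict-fan fan i α i≤ℓ α<k
        (λ l _ → kempeChange-outside col α<k β<k offWalk offWalk-closed u _ (onWalk⇒offWalk≡false onWalk-start))
        kept
        (kempeChange-missing-swapped col α<k β<k offWalk offWalk-closed (vs i) (¬onWalk⇒offWalk≡true off)
          (subst (¬_ ∘ InPalette G c (vs i)) bsi≡β (fan-missing fan i i≤ℓ))))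
      (subst (¬_ ∘ InPalette G c′ u) (sym (update-same bs i α))
        (kempeChange-missing-outside col α<k β<k offWalk offWalk-closed u (onWalk⇒offWalk≡false onWalk-start) α∉u))

    result : Extended
    result = rotate-by (onWalk? (vs j))
      where
      β∉ : ∀ l → l ≤ ℓ → bs l ≡ β → partner simple col β (vs l) ≡ nothing
      β∉ l l≤ℓ bsl≡β = partner-missing simple col β (subst (¬_ ∘ InPalette G c (vs l)) bsl≡β (fan-missing fan l l≤ℓ))
      rotate-by : Dec (OnWalk (vs j)) → Extended
      rotate-by (no off) = rotate-at j (<⇒≤ j<ℓ) off bsj≡bsℓ (λ l l<j → missing-kept l (<-trans l<j j<ℓ) (inj₁ (<⇒≢ l<j)))
      rotate-by (yes on) = rotate-at ℓ ≤-refl last-off refl (λ l l<ℓ → missing-kept l l<ℓ (unless-j (l ℕ.≟ j)))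
        where
        last-off : ¬ OnWalk (vs ℓ)
        last-off on′ = <⇒≢ j<ℓ (fan-injective fan j ℓ (<⇒≤ j<ℓ) ≤-refl
          (walk-end-unique on on′ (β∉ j (<⇒≤ j<ℓ) bsj≡bsℓ) (β∉ ℓ ≤-refl refl)))
        unless-j : ∀ {l} → Dec (l ≡ j) → l ≢ j ⊎ OnWalk (vs l)
        unless-j (yes refl) = inj₂ on
        unless-j (no l≢j) = inj₁ l≢j

  -- The fuel f bounds the number of further extensions: a fan has fewer than n vertices.
  grow : ∀ {c} → IsColouring k G c → ∀ f {ℓ vs bs} → Fan k G c u v ℓ vs bs → ℓ + f ≡ n → Extended
  grow {c} col f {ℓ} {vs} {bs} fan ℓ+f≡n with inPalette? G c u (bs ℓ)
  ... | no last-missing = rotate col fan last-missing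
  ... | yes (w , uw , cuw≡bsℓ) with inFan? ℓ vs w | missing-colour col u (deg< u) | missing-colour col w (deg< w)
  ...   | yes (zero , _ , v≡w) | _ | _ =
    contradiction (trans (sym uw) (subst (λ y → adj G u y ≡ false) (trans (sym (fan-start fan)) v≡w) ¬uv)) λ ()
  ...   | yes (suc j , 1+j<1+ℓ , refl) | α , α<k , α∉u | _ = KempeCase.result col fan j (s≤s⁻¹ 1+j<1+ℓ)
    (trans (sym (fan-colour fan j (s≤s⁻¹ 1+j<1+ℓ))) cuw≡bsℓ) α<k α∉u
  ...   | no w∉ | _ | γ , γ<k , γ∉ with f
  ...     | zero = contradiction (trans (sym (+-identityʳ ℓ)) ℓ+f≡n) (<⇒≢ (fan-length col fan))
  ...     | suc f′ = grow col f′ (extend-fan fan w γ uw cuw≡bsℓ w∉ γ<k γ∉) (trans (sym (+-suc ℓ f′)) ℓ+f≡n)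

  extend : ∀ {c} → IsColouring k G c → Extended
  extend {c} col with missing-colour col v (deg< v)
  ... | γ , γ<k , γ∉ = grow col n fan₀ refl
    where
    fan₀ : Fan k G c u v 0 (λ _ → v) (λ _ → γ)
    fan₀ = record
      { fan-start = refl
      ; fan-spoke = λ _ ()
      ; fan-colour = λ _ ()
      ; fan-missing = λ _ _ → γ∉
      ; fan-injective = λ { zero zero z≤n z≤n _ → refl }
      ; fan-< = λ _ _ → γ<k
      }

-- Vizing's theorem
_⊆ᴳ_ : ∀ {n} → Graph n → Graph n → Set
A ⊆ᴳ H = ∀ x y → adj A x y ≡ true → adj H x y ≡ true

emptyGraph : ∀ {n} → Graph n
emptyGraph = record { adj = λ _ _ → false }

missingArc : ∀ {n} → Graph n → Graph n → Fin n × Fin n → Bool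
missingArc H A (x , y) = adj H x y ∧ not (adj A x y)

-- Indexed through remQuot, so that the missing arcs can be counted.
missingArcs : ∀ {n} → Graph n → Graph n → Fin (n * n) → Bool
missingArcs {n} H A i = missingArc H A (remQuot n i)

module _ {n} (H A : Graph n) (x y : Fin n) where

  missingArc-elim : missingArc H A (x , y) ≡ true → adj H x y ≡ true × adj A x y ≡ false
  missingArc-elim eq with adj H x y | adj A x y
  ... | true | false = refl , refl
  ... | true | true = contradiction eq λ ()
  ... | false | _ = contradiction eq λ ()

  missingArc-intro : adj H x y ≡ true → adj A x y ≡ false → missingArc H A (x , y) ≡ true
  missingArc-intro xy ¬xy rewrite xy | ¬xy = refl

missingArcs-combine : ∀ {n} (H A : Graph n) u v → missingArcs H A (combine u v) ≡ missingArc H A (u , v)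
missingArcs-combine H A u v = cong (missingArc H A) (remQuot-combine u v)

missingArc-addEdge : ∀ {n} (H A : Graph n) u v p → missingArc H (addEdge A u v) p ≡ true → missingArc H A p ≡ true
missingArc-addEdge H A u v (x , y) eq with missingArc-elim H (addEdge A u v) x y eq
... | Hxy , ¬A′xy = missingArc-intro H A x y Hxy (not-in-A (adj A x y) refl)
  where
  not-in-A : ∀ b → adj A x y ≡ b → adj A x y ≡ false
  not-in-A false Axy = Axy
  not-in-A true Axy = contradiction (trans (sym (addEdge-old A u v x y Axy)) ¬A′xy) λ ()

colouring-⊆ : ∀ {n k} {A H : Graph n} {c} → A ⊆ᴳ H → IsColouring k H c → IsColouring k A c
colouring-⊆ A⊆H col = record
  { colour-sym = λ x y xy → colour-sym col x y (A⊆H x y xy)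
  ; colour-proper = λ x y z xy xz → colour-proper col x y z (A⊆H x y xy) (A⊆H x z xz)
  ; colour-< = λ x y xy → colour-< col x y (A⊆H x y xy)
  }

deg-⊆ : ∀ {n} {A H : Graph n} → A ⊆ᴳ H → ∀ x → deg A x ≤ deg H x
deg-⊆ A⊆H x = count-mono (A⊆H x)

module _ {n D} {H : Graph n} (H-simple : IsSimple H) (H-deg : ∀ x → deg H x ≤ D) where

  colour-from-subgraph : ∀ N (A : Graph n) {c} → IsSimple A → A ⊆ᴳ H → IsColouring (suc D) A c →
    count (missingArcs H A) ≤ N → ∃ λ c′ → IsColouring (suc D) H c′
  colour-from-subgraph N A {c} A-simple A⊆H col bound
    with any? (λ u → any? (λ v → missingArc H A (u , v) Bool.≟ true))
  ... | no complete = c , colouring-⊆ H⊆A col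
    where
    H⊆A : H ⊆ᴳ A
    H⊆A x y xy with adj A x y in axy
    ... | true = refl
    ... | false = contradiction (x , y , missingArc-intro H A x y xy axy) complete
  ... | yes (u , v , uv-missing) with N | missingArc-elim H A u v uv-missing
  ...   | zero | _ = contradiction (<-≤-trans (count-positive (combine u v) uv-missing′) bound) n≮0
    where
    uv-missing′ : missingArcs H A (combine u v) ≡ true
    uv-missing′ = trans (missingArcs-combine H A u v) uv-missing
  ...   | suc N′ | Huv , ¬Auv = colour-from-subgraph N′ A′ (addEdge-simple A u v A-simple u≢v) A′⊆H
    (proj₂ (Extension.extend A-simple (λ x → s≤s (≤-trans (deg-⊆ A⊆H x) (H-deg x))) u≢v ¬Auv col))
    (s≤s⁻¹ (<-≤-trans fewer-missing bound))
    where
    A′ : Graph n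
    A′ = addEdge A u v
    u≢v : u ≢ v
    u≢v refl = contradiction (trans (sym Huv) (proj₂ H-simple u)) λ ()
    A′⊆H : A′ ⊆ᴳ H
    A′⊆H x y xy with addEdge-cases A u v x y xy
    ... | inj₁ Axy = A⊆H x y Axy
    ... | inj₂ (inj₁ (refl , refl)) = Huv
    ... | inj₂ (inj₂ (refl , refl)) = trans (proj₁ H-simple x y) Huv
    shrinks : ∀ i → missingArcs H A′ i ≡ true → missingArcs H A i ≡ true
    shrinks i = missingArc-addEdge H A u v (remQuot n i)
    uv-added : missingArcs H A′ (combine u v) ≡ false
    uv-added rewrite missingArcs-combine H A′ u v | addEdge-new A u v = ∧-zeroʳ (adj H u v)
    fewer-missing : count (missingArcs H A′) < count (missingArcs H A)
    fewer-missing = count-mono-< shrinks (combine u v) uv-added (trans (missingArcs-combine H A u v) uv-missing)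

  vizing : ∃ λ c → IsColouring (suc D) H c
  vizing = colour-from-subgraph (n * n) emptyGraph ((λ _ _ → refl) , (λ _ → refl)) (λ _ _ ()) empty-colouring
    (∣p∣≤n (tabulate (missingArcs H emptyGraph)))
    where
    empty-colouring : IsColouring (suc D) emptyGraph (λ _ _ → 0)
    empty-colouring = record { colour-sym = λ _ _ () ; colour-proper = λ _ _ _ () ; colour-< = λ _ _ () }

-- The product colouring
⌊≟⌋-refl : ∀ {k} (x : Fin k) → ⌊ x ≟ x ⌋ ≡ true
⌊≟⌋-refl x = trans (isYes≗does (x ≟ x)) (dec-true (x ≟ x) refl)

module ProductColouring {n m} (G : Graph n) (H : Graph m) (G-simple : IsSimple G)
  {d} {g : EdgeColouring n} (g-col : IsColouring (suc d) G g) (g-full : ∀ x t → t < suc d → InPalette G g x t)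
  {r} {h : EdgeColouring m} (h-col : IsColouring (suc r) H h)
  (μ : Fin m → ℕ) (μ< : ∀ y → μ y < suc r) (μ∉ : ∀ y → ¬ InPalette H h y (μ y))
  (h-full : ∀ y γ → γ < suc r → γ ≢ μ y → InPalette H h y γ) where

  Vertex : Set
  Vertex = Fin n × Fin m

  -- adj (G □ H) i j unfolds to pairAdj (remQuot m i) (remQuot m j).
  pairAdj : Vertex → Vertex → Bool
  pairAdj (x , y) (x′ , y′) = (adj G x x′ ∧ ⌊ y ≟ y′ ⌋) ∨ (adj H y y′ ∧ ⌊ x ≟ x′ ⌋)

  pairAdj-cases : ∀ x y x′ y′ → pairAdj (x , y) (x′ , y′) ≡ true →
    (adj G x x′ ≡ true × y ≡ y′) ⊎ (adj H y y′ ≡ true × x ≡ x′)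
  pairAdj-cases x y x′ y′ adj′ with adj G x x′ | y ≟ y′ | adj H y y′ | x ≟ x′
  ... | true | yes y≡y′ | _ | _ = inj₁ (refl , y≡y′)
  ... | _ | _ | true | yes x≡x′ = inj₂ (refl , x≡x′)
  ... | false | _ | false | _ = contradiction adj′ λ ()
  ... | false | _ | true | no _ = contradiction adj′ λ ()
  ... | true | no _ | false | _ = contradiction adj′ λ ()
  ... | true | no _ | true | no _ = contradiction adj′ λ ()

  pairAdj-G : ∀ {x x′} y → adj G x x′ ≡ true → pairAdj (x , y) (x′ , y) ≡ true
  pairAdj-G y xx′ rewrite xx′ | ⌊≟⌋-refl y = refl

  pairAdj-H : ∀ x {y y′} → adj H y y′ ≡ true → pairAdj (x , y) (x , y′) ≡ true
  pairAdj-H x {y} yy′ rewrite yy′ | ⌊≟⌋-refl x = ∨-zeroʳ _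

  layerColour : Fin m → ℕ → ℕ
  layerColour y zero = μ y
  layerColour y (suc t) = suc (r + t)

  pairColour : Vertex → Vertex → ℕ
  pairColour (x , y) (x′ , y′) with x ≟ x′
  ... | yes _ = h y y′
  ... | no _ = layerColour y (g x x′)

  pairColour-G : ∀ {x x′} y y′ → adj G x x′ ≡ true → pairColour (x , y) (x′ , y′) ≡ layerColour y (g x x′)
  pairColour-G {x} {x′} y y′ xx′ with x ≟ x′
  ... | yes refl = contradiction (trans (sym xx′) (proj₂ G-simple x)) λ ()
  ... | no _ = refl

  pairColour-H : ∀ x y y′ → pairColour (x , y) (x , y′) ≡ h y y′
  pairColour-H x y y′ with x ≟ x
  ... | yes _ = refl
  ... | no x≢x = contradiction refl x≢x

  layerColour-injective : ∀ y s t → layerColour y s ≡ layerColour y t → s ≡ t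
  layerColour-injective y zero zero _ = refl
  layerColour-injective y zero (suc t) eq = contradiction eq (<⇒≢ (≤-trans (μ< y) (s≤s (m≤m+n r t))))
  layerColour-injective y (suc s) zero eq = contradiction (sym eq) (<⇒≢ (≤-trans (μ< y) (s≤s (m≤m+n r s))))
  layerColour-injective y (suc s) (suc t) eq = cong suc (+-cancelˡ-≡ r s t (suc-injective eq))

  layerColour-fresh : ∀ y y′ t → adj H y y′ ≡ true → layerColour y t ≢ h y y′
  layerColour-fresh y y′ zero yy′ eq = μ∉ y (y′ , yy′ , sym eq)
  layerColour-fresh y y′ (suc t) yy′ eq = <⇒≢ (≤-trans (colour-< h-col y y′ yy′) (s≤s (m≤m+n r t))) (sym eq)

  layerColour-< : ∀ y t → t < suc d → layerColour y t < suc (r + d)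
  layerColour-< y zero _ = ≤-trans (μ< y) (s≤s (m≤m+n r d))
  layerColour-< y (suc t) t<d = s≤s (+-monoʳ-< r (s≤s⁻¹ t<d))

  pair-sym : ∀ p q → pairAdj p q ≡ true → pairColour p q ≡ pairColour q p
  pair-sym (x , y) (x′ , y′) pq with pairAdj-cases x y x′ y′ pq
  ... | inj₁ (xx′ , refl) = trans (pairColour-G y y xx′)
        (trans (cong (layerColour y) (colour-sym g-col x x′ xx′))
          (sym (pairColour-G y y (trans (proj₁ G-simple x′ x) xx′))))
  ... | inj₂ (yy′ , refl) = trans (pairColour-H x y y′) (trans (colour-sym h-col y y′ yy′) (sym (pairColour-H x y′ y)))

  pair-proper : ∀ p q q′ → pairAdj p q ≡ true → pairAdj p q′ ≡ true → q ≢ q′ → pairColour p q ≢ pairColour p q′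
  pair-proper (x , y) (x₁ , y₁) (x₂ , y₂) pq pq′ q≢q′ eq
    with pairAdj-cases x y x₁ y₁ pq | pairAdj-cases x y x₂ y₂ pq′
  ... | inj₁ (xx₁ , refl) | inj₁ (xx₂ , refl) = colour-proper g-col x x₁ x₂ xx₁ xx₂ (λ { refl → q≢q′ refl })
        (layerColour-injective y _ _ (trans (sym (pairColour-G y y xx₁)) (trans eq (pairColour-G y y xx₂))))
  ... | inj₂ (yy₁ , refl) | inj₂ (yy₂ , refl) = colour-proper h-col y y₁ y₂ yy₁ yy₂ (λ { refl → q≢q′ refl })
        (trans (sym (pairColour-H x y y₁)) (trans eq (pairColour-H x y y₂)))
  ... | inj₁ (xx₁ , refl) | inj₂ (yy₂ , refl) = layerColour-fresh y y₂ (g x x₁) yy₂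
        (trans (sym (pairColour-G y y xx₁)) (trans eq (pairColour-H x y y₂)))
  ... | inj₂ (yy₁ , refl) | inj₁ (xx₂ , refl) = layerColour-fresh y y₁ (g x x₂) yy₁
        (trans (sym (pairColour-G y y xx₂)) (trans (sym eq) (pairColour-H x y y₁)))

  pair-palette-< : ∀ p q → pairAdj p q ≡ true → pairColour p q < suc (r + d)
  pair-palette-< (x , y) (x′ , y′) pq with pairAdj-cases x y x′ y′ pq
  ... | inj₁ (xx′ , refl) = subst (_< suc (r + d)) (sym (pairColour-G y y xx′)) (layerColour-< y (g x x′) (colour-< g-col x x′ xx′))
  ... | inj₂ (yy′ , refl) = subst (_< suc (r + d)) (sym (pairColour-H x y y′)) (≤-trans (colour-< h-col y y′ yy′) (s≤s (m≤m+n r d)))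

  layerColour-present : ∀ x y t → t < suc d → ∃ λ q → pairAdj (x , y) q ≡ true × pairColour (x , y) q ≡ layerColour y t
  layerColour-present x y t t<1+d with g-full x t t<1+d
  ... | x′ , xx′ , gxx′≡t = (x′ , y) , pairAdj-G y xx′ , trans (pairColour-G y y xx′) (cong (layerColour y) gxx′≡t)

  pair-palette-complete : ∀ p γ → γ < suc (r + d) → ∃ λ q → pairAdj p q ≡ true × pairColour p q ≡ γ
  pair-palette-complete (x , y) γ γ<1+r+d with γ <? suc r
  ... | no γ≮1+r = subst (λ δ → ∃ λ q → pairAdj (x , y) q ≡ true × pairColour (x , y) q ≡ δ) γ≡
        (layerColour-present x y (suc t) (s≤s (+-cancelˡ-< (suc r) t d (subst (_< suc (r + d)) (sym γ≡) γ<1+r+d))))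
    where
    t : ℕ
    t = γ ∸ suc r
    γ≡ : suc (r + t) ≡ γ
    γ≡ = m+[n∸m]≡n (≮⇒≥ γ≮1+r)
  ... | yes γ<1+r with γ ℕ.≟ μ y
  ...   | yes refl = layerColour-present x y zero (s≤s z≤n)
  ...   | no γ≢μ with h-full y γ γ<1+r γ≢μ
  ...     | y′ , yy′ , hyy′≡γ = (x , y′) , pairAdj-H x yy′ , trans (pairColour-H x y y′) hyy′≡γ

  productColour : EdgeColouring (n * m)
  productColour i j = pairColour (remQuot m i) (remQuot m j)

  remQuot-injective : ∀ {i j : Fin (n * m)} → remQuot {n} m i ≡ remQuot m j → i ≡ j
  remQuot-injective {i} {j} eq =
    trans (sym (combine-remQuot {n} m i)) (trans (cong (λ (x , y) → combine x y) eq) (combine-remQuot {n} m j))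

  productColour-proper : IsProper (G □ H) productColour
  productColour-proper = (λ i j ij → pair-sym (remQuot m i) (remQuot m j) ij)
    , (λ i j j′ ij ij′ j≢j′ → pair-proper (remQuot m i) (remQuot m j) (remQuot m j′) ij ij′ (j≢j′ ∘ remQuot-injective))

  product-palette : ∀ i γ → InPalette (G □ H) productColour i γ ⇔ γ < suc (r + d)
  product-palette i γ = mk⇔
    (λ (j , ij , eq) → subst (_< suc (r + d)) eq (pair-palette-< (remQuot m i) (remQuot m j) ij))
    (λ γ< → let ((x , y) , adj′ , colour′) = pair-palette-complete (remQuot m i) γ γ< in
      combine x y , subst (λ q → pairAdj (remQuot m i) q ≡ true) (sym (remQuot-combine x y)) adj′
                  , subst (λ q → pairColour (remQuot m i) q ≡ γ) (sym (remQuot-combine x y)) colour′)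

  product-same-palette : ∀ i j → SamePalette (G □ H) productColour i j
  product-same-palette i j γ = ⇔.trans (product-palette i γ) (⇔.sym (product-palette j γ))

maxDeg-≤ : ∀ {n} (G : Graph n) {d} → (∀ v → deg G v ≤ d) → maxDeg G ≤ d
maxDeg-≤ {n} G {d} deg≤d = go (allFin n)
  where
  go : ∀ (vs : List (Fin n)) → foldr _⊔_ 0 (map (deg G) vs) ≤ d
  go [] = z≤n
  go (v ∷ vs) = ⊔-lub (deg≤d v) (go vs)

walk⇒0<deg : ∀ {n} {G : Graph n} {x y} → Walk G x y → x ≢ y → 0 < deg G x
walk⇒0<deg here x≢x = contradiction refl x≢x
walk⇒0<deg (step {w = w} xw _) _ = count-positive w xw

regular-class1-colouring : ∀ {n} (G : Graph n) {d} → (∀ v → deg G v ≡ d) → Class1 G → ∃ λ g → IsColouring d G g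
regular-class1-colouring G G-reg ((g , g-proper , g-uses) , _) = g , record
  { colour-sym = proj₁ g-proper
  ; colour-proper = proj₂ g-proper
  ; colour-< = λ x y xy → ≤-trans (g-uses x y xy) (maxDeg-≤ G (≤-reflexive ∘ G-reg))
  }

□-single-palette : ∀ {n m} (G : Graph n) (H : Graph m) → IsSimple G → IsSimple H → ∀ {d r} →
  (∀ x → deg G x ≡ suc d) → (∀ y → deg H y ≡ r) → ∃ (IsColouring (suc d) G) →
  ∃ λ f → IsProper (G □ H) f × ∀ u v → SamePalette (G □ H) f u v
□-single-palette {m = m} G H G-simple H-simple {r = r} G-reg H-reg (g , g-col) =
  productColour , productColour-proper , product-same-palette
  where
  h : EdgeColouring m
  h = proj₁ (vizing H-simple (≤-reflexive ∘ H-reg))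
  h-col : IsColouring (suc r) H h
  h-col = proj₂ (vizing H-simple (≤-reflexive ∘ H-reg))
  missing : ∀ y → ∃ λ γ → γ < suc r × ¬ InPalette H h y γ
  missing y = missing-colour h-col y (subst (_< suc r) (sym (H-reg y)) (n<1+n r))
  μ : Fin m → ℕ
  μ y = proj₁ (missing y)
  open ProductColouring G H G-simple g-col (λ x → palette-complete g-col x (G-reg x)) h-col μ
    (proj₁ ∘ proj₂ ∘ missing) (proj₂ ∘ proj₂ ∘ missing)
    (λ y → palette-all-but-one h-col y (cong suc (H-reg y)) (μ y) (proj₁ (proj₂ (missing y))) (proj₂ (proj₂ (missing y))))

samePalettes⇒PaletteIndex1 : ∀ {N} (K : Graph N) → (∃ λ f → IsProper K f × ∀ u v → SamePalette K f u v) →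
  Fin N → PaletteIndex K 1
samePalettes⇒PaletteIndex1 K (f , f-proper , same) v₀ =
  (f , f-proper , (λ _ → zero) , (λ { zero → v₀ , refl }) , (λ u v → mk⇔ (λ _ → same u v) (λ _ → refl)))
  , at-least-one
  where
  at-least-one : ∀ f′ k → IsProper K f′ → NumPalettes K f′ k → 1 ≤ k
  at-least-one _ zero _ (cl , _) with cl v₀
  ... | ()
  at-least-one _ (suc _) _ _ = s≤s z≤n

corollary1 : ∀ {n m} (G : Graph n) (H : Graph m) →
    IsSimple G → IsSimple H →
    Connected G → Connected H → Regular G → Regular H →
    Nontrivial G → Class1 G →
    PaletteIndex (G □ H) 1
corollary1 {n} {m} G H G-simple H-simple (_ , G-walk) (s≤s z≤n , _) (d , G-reg) (r , H-reg) (s≤s (s≤s z≤n))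
  class1 with d | G-reg | walk⇒0<deg (G-walk zero (suc zero)) (λ ())
... | zero | G-reg′ | deg>0 = contradiction (subst (0 <_) (G-reg′ zero) deg>0) λ ()
... | suc _ | G-reg′ | _ = samePalettes⇒PaletteIndex1 (G □ H)
  (□-single-palette G H G-simple H-simple G-reg′ H-reg (regular-class1-colouring G G-reg′ class1)) (combine {n} {m} zero zero)
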